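{- Let $H$ be a connected graph, let $\mathbb G$ be a linear graph, let $\mathbf H \in \mathcal H$ be a pattern relaxation of $H$, let $\mathbb K$ be a linear piece of $\mathbf H$ and let $z$ be the maximum vertex of $\mathbb K$. Then for every embedding $\phi$ of $\mathbf H$ into $\mathbb G$ it holds that $\phi(V(\mathbb K)) \subseteq W^{|H|}_{\mathbb G}[\phi(z)]$, where $|H|$ is the number of vertices of $H$.
   Context: A tree order on a finite set $S$ is a partial order $\preccurlyeq$ such that for every $x$ the set $\{y : y \preccurlyeq x\}$ is totally ordered. A tree-ordered graph (tog) $\mathbf G = (G, \preccurlyeq_{\mathbf G})$ is a finite graph with a tree order on $V(G)$ such that every edge $uv$ has $u \preccurlyeq_{\mathbf G} v$ or $v \preccurlyeq_{\mathbf G} u$; if the order is total it is a linear graph (written $\mathbb G$, order $\leq_{\mathbb G}$). For $X \subseteq V(\mathbf G)$, $\mathbf G[X] = (G[X], \preccurlyeq_{\mathbf G}|_X)$. The root path of $x$ is $\{y : y \preccurlyeq_{\mathbf G} x\}$ and the leaves of $\mathbf G$ are its $\preccurlyeq_{\mathbf G}$-maximal vertices. For a connected linear graph $\mathbb H$, its elimination tree $\operatorname{ET}(\mathbb H)$ is: root $x = \min \mathbb H$, whose children are the roots of $\operatorname{ET}(\mathbb K_i)$ for the connected components $\mathbb K_i$ of $\mathbb H - x$; $\operatorname{rel}(\mathbb H)$ is the tog $(H, \preccurlyeq)$ with $u \preccurlyeq v$ iff $u$ is an ancestor of or equal to $v$ in $\operatorname{ET}(\mathbb H)$. For a connected graph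 $H$, the set of pattern relaxations is $\mathcal H = \{\operatorname{rel}((H, \leq)) : \leq \text{ a linear order of } V(H)\}$. For $\mathbf H \in \mathcal H$ and a nonempty set $S$ of leaves of $\mathbf H$, the piece induced by $S$ is $\mathbf H[\bigcup_{x \in S} \text{rootpath}(x)]$; if $|S| = 1$ it is linearly ordered and called a linear piece. An embedding of a tog $\mathbf H$ into a tog $\mathbf G$ is an injective map $\phi: V(H) \to V(G)$ such that $uv \in E(H) \iff \phi(u)\phi(v) \in E(G)$ and $u \preccurlyeq_{\mathbf H} v \implies \phi(u) \preccurlyeq_{\mathbf G} \phi(v)$. For a linear graph $\mathbb G$, a vertex $u$ and integer $r$, $W^r_{\mathbb G}(u)$ is the set of vertices $\min_{\leq_{\mathbb G}} V(P)$ over all paths $P$ in $G$ with at most $r$ edges having $u$ as an endpoint, and $W^r_{\mathbb G}[u] = W^r_{\mathbb G}(u) \cup \{u\}$. -}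

module Defs where

open import Data.Nat using (ℕ)
open import Data.Fin using (Fin) renaming (_≤_ to _≤ᶠ_)
open import Data.List using (List; []; _∷_; length)
open import Data.List.Relation.Unary.Any using (Any)
open import Data.List.Relation.Unary.All using (All)
open import Data.List.Relation.Unary.Unique.Propositional using (Unique)
open import Data.List.Membership.Propositional using (_∈_)
open import Data.Product using (Σ; ∃; _×_)
open import Data.Sum using (_⊎_)
open import Data.Unit using (⊤)
open import Data.Empty using (⊥)
open import Function.Definitions using (Injective)
open import Relation.Binary.PropositionalEquality using (_≡_; _≢_)
open import Relation.Nullary using (¬_)
open import Level using (0ℓ) renaming (suc to lsuc)

record Graph (n : ℕ) : Set₁ where
  field
    E     : Fin n → Fin n → Set
    sym   : ∀ {u v} → E u v → E v u
    irrefl : ∀ {u} → ¬ E u u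
open Graph public

-- A linear order on Fin n, given by an injective (hence bijective)
-- position map: u ≤ v iff pos u ≤ pos v.
record LinOrd (n : ℕ) : Set where
  field
    pos    : Fin n → Fin n
    pos-inj : Injective _≡_ _≡_ pos
open LinOrd public

_⟨_⟩≤_ : ∀ {n} → Fin n → LinOrd n → Fin n → Set
u ⟨ L ⟩≤ v = pos L u ≤ᶠ pos L v

VSet : ℕ → Set₁
VSet n = Fin n → Set

module _ {n : ℕ} (G : Graph n) where

  data ReachIn (X : VSet n) : Fin n → Fin n → Set where
    stop : ∀ {a} → X a → ReachIn X a a
    step : ∀ {a c b} → X a → E G a c → ReachIn X c b → ReachIn X a b

  Connected : Set
  Connected = ∀ u v → ReachIn (λ _ → ⊤) u v

  data Chain : List (Fin n) → Set where
    nil  : Chain []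
    one  : ∀ {x} → Chain (x ∷ [])
    cons : ∀ {x y vs} → E G x y → Chain (y ∷ vs) → Chain (x ∷ y ∷ vs)

  record PathFrom (r : ℕ) (u : Fin n) : Set where
    field
      rest   : List (Fin n)
      chain  : Chain (u ∷ rest)
      unique : Unique (u ∷ rest)
      short  : length rest Data.Nat.≤ r
  open PathFrom public

  W[_] : LinOrd n → ℕ → Fin n → VSet n
  W[ L ] r u w = w ≡ u ⊎
    Σ (PathFrom r u) λ P →
      (w ∈ (u ∷ rest P)) × All (λ y → w ⟨ L ⟩≤ y) (u ∷ rest P)

  -- Elimination tree of a connected linear graph, via its ancestor relation
  module _ (L : LinOrd n) where

    IsMin : VSet n → Fin n → Set
    IsMin X x = X x × (∀ w → X w → x ⟨ L ⟩≤ w)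

    IsComponent : VSet n → VSet n → Set
    IsComponent X K =
      (∀ w → K w → X w) ×
      ∃ K ×
      (∀ a b → K a → K b → ReachIn K a b) ×
      (∀ a b → K a → X b → E G a b → K b)

    Minus : VSet n → Fin n → VSet n
    Minus X x w = X w × w ≢ x

    -- ETAnc X u v : u is an ancestor of (or equal to) v in ET(G[X])
    data ETAnc (X : VSet n) : Fin n → Fin n → Set₁ where
      root  : ∀ {x v} → IsMin X x → X v → ETAnc X x v
      child : ∀ {x K u v} → IsMin X x → IsComponent (Minus X x) K →
              ETAnc K u v → ETAnc X u v

    Rel : Fin n → Fin n → Set₁
    Rel = ETAnc (λ _ → ⊤)

record Embedding {n m : ℕ} (H : Graph n) (≼ : Fin n → Fin n → Set₁)
                 (G : Graph m) (L : LinOrd m) : Set₁ where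
  field
    φ     : Fin n → Fin m
    inj   : Injective _≡_ _≡_ φ
    edges : ∀ u v → (E H u v → E G (φ u) (φ v)) × (E G (φ u) (φ v) → E H u v)
    mono  : ∀ u v → ≼ u v → φ u ⟨ L ⟩≤ φ v
open Embedding public

module Submission where

-- Let y be a vertex of the linear piece K, so y ≼ z in the
-- elimination-tree order rel(H, LH).  Every vertex w of the subtree rooted
-- at y satisfies y ≼ w, hence φ(y) ≤ φ(w) in G.  The subtree of y is the
-- vertex set of a connected subgraph of H, so z reaches y by a walk of H
-- inside that subtree; shortcutting repeated vertices turns it into a path
-- with at most |H| vertices.  Its image under φ is a path of G starting at
-- φ(z), of length < |H|, passing through φ(y) and whose minimum is φ(y):
-- exactly a witness that φ(y) ∈ W^{|H|}[φ(z)].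

open import Defs
open import Data.Nat using (ℕ; _≤_)
open import Data.Nat.Properties using (≤-trans; n≤1+n)
open import Data.Fin using (Fin; zero; suc)
open import Data.Fin.Properties using (injective⇒≤; _≟_)
open import Data.List using (List; []; _∷_; length; map; lookup)
open import Data.List.Properties using (length-map)
open import Data.List.Relation.Unary.All as All using (All; []; _∷_)
import Data.List.Relation.Unary.All.Properties as AllP
open import Data.List.Relation.Unary.Any using (here; there)
open import Data.List.Relation.Unary.AllPairs using ([]; _∷_)
open import Data.List.Relation.Unary.Unique.Propositional using (Unique)
import Data.List.Relation.Unary.Unique.Propositional.Properties as UniqueP
open import Data.List.Membership.Propositional using (_∈_)
open import Data.List.Membership.Propositional.Properties using (∈-map⁺; ∈-lookup)
open import Data.Product using (∃; _×_; _,_; proj₁; proj₂)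
open import Data.Sum using (inj₂)
open import Data.Empty using (⊥-elim)
open import Function.Definitions using (Injective)
open import Relation.Nullary using (yes; no)
open import Relation.Binary.PropositionalEquality using (_≡_; refl; cong; subst) renaming (sym to ≡-sym)

lookup-injective : ∀ {A : Set} {xs : List A} → Unique xs → Injective _≡_ _≡_ (lookup xs)
lookup-injective (_ ∷ _) {zero} {zero} _ = refl
lookup-injective (x∉xs ∷ _) {zero} {suc j} eq = ⊥-elim (All.lookup x∉xs (∈-lookup j) eq)
lookup-injective (x∉xs ∷ _) {suc i} {zero} eq = ⊥-elim (All.lookup x∉xs (∈-lookup i) (≡-sym eq))
lookup-injective (_ ∷ xs!) {suc i} {suc j} eq = cong suc (lookup-injective xs! eq)

unique-length≤ : ∀ {k} {xs : List (Fin k)} → Unique xs → length xs ≤ k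
unique-length≤ xs! = injective⇒≤ (lookup-injective xs!)

module _ {n : ℕ} (H : Graph n) where
  open import Data.List.Membership.DecPropositional (_≟_ {n}) using (_∈?_)

  reach-mono : ∀ {X Y : VSet n} → (∀ {w} → X w → Y w) →
               ∀ {a b} → ReachIn H X a b → ReachIn H Y a b
  reach-mono X⊆Y (stop Xa) = stop (X⊆Y Xa)
  reach-mono X⊆Y (step Xa e r) = step (X⊆Y Xa) e (reach-mono X⊆Y r)

  data Walk (X : VSet n) : Fin n → Fin n → List (Fin n) → Set where
    stop : ∀ {a} → X a → Walk X a a []
    step : ∀ {a c b vs} → E H a c → X a → Walk X c b vs → Walk X a b (c ∷ vs)

  walk-end : ∀ {X a b vs} → Walk X a b vs → b ∈ a ∷ vs
  walk-end (stop _) = here refl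
  walk-end (step _ _ w) = there (walk-end w)

  walk-inside : ∀ {X a b vs} → Walk X a b vs → All X (a ∷ vs)
  walk-inside (stop Xa) = Xa ∷ []
  walk-inside (step _ Xa w) = Xa ∷ walk-inside w

  walk-chain : ∀ {X a b vs} → Walk X a b vs → Chain H (a ∷ vs)
  walk-chain (stop _) = one
  walk-chain (step e _ w) = cons e (walk-chain w)

  walk-suffix : ∀ {X a b c vs} → Walk X a b vs → Unique (a ∷ vs) → c ∈ a ∷ vs →
                ∃ λ ws → Walk X c b ws × Unique (c ∷ ws)
  walk-suffix w vs! (here refl) = _ , w , vs!
  walk-suffix (step _ _ w) (_ ∷ vs!) (there c∈vs) = walk-suffix w vs! c∈vs

  shortcut : ∀ {X a b} → ReachIn H X a b → ∃ λ vs → Walk X a b vs × Unique (a ∷ vs)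
  shortcut (stop Xa) = [] , stop Xa , [] ∷ []
  shortcut {a = a} (step {c = c} Xa e r) with shortcut r
  ... | vs , w , cvs! with a ∈? c ∷ vs
  ...   | yes a∈cvs = walk-suffix w cvs! a∈cvs
  ...   | no a∉cvs = c ∷ vs , step e Xa w , AllP.¬Any⇒All¬ (c ∷ vs) a∉cvs ∷ cvs!

  descendant-walk : (L : LinOrd n) {X : VSet n} {u v : Fin n} (Q : VSet n) →
    (∀ {w} → ETAnc H L X u w → Q w) →
    (∀ a b → X a → X b → ReachIn H X a b) →
    ETAnc H L X u v → ReachIn H Q v u
  descendant-walk L Q toQ connX (root x-min Xv) =
    reach-mono (λ Xw → toQ (root x-min Xw)) (connX _ _ Xv (proj₁ x-min))
  descendant-walk L Q toQ connX (child x-min K-comp anc) =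
    descendant-walk L Q (λ anc′ → toQ (child x-min K-comp anc′))
      (proj₁ (proj₂ (proj₂ K-comp))) anc

module _ {n m : ℕ} {H : Graph n} {G : Graph m} (f : Fin n → Fin m)
         (f-edge : ∀ {u v} → E H u v → E G (f u) (f v)) where

  chain-map : ∀ {vs} → Chain H vs → Chain G (map f vs)
  chain-map nil = nil
  chain-map one = one
  chain-map (cons e c) = cons (f-edge e) (chain-map c)

  image-path : Injective _≡_ _≡_ f → ∀ {X a b vs} →
               Walk H X a b vs → Unique (a ∷ vs) → PathFrom G n (f a)
  image-path f-inj {vs = vs} w avs! = record
    { rest   = map f vs
    ; chain  = chain-map (walk-chain H w)
    ; unique = UniqueP.map⁺ f-inj avs!
    ; short  = subst (_≤ n) (≡-sym (length-map f vs))
                 (≤-trans (n≤1+n (length vs)) (unique-length≤ avs!))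
    }

lemma2 : ∀ {n m : ℕ} (H : Graph n) → Connected H →
    (G : Graph m) (LG : LinOrd m) →
    (LH : LinOrd n) →
    (ℓ : Fin n) → (∀ w → Rel H LH ℓ w → w ≡ ℓ) →
    (z : Fin n) → Rel H LH z ℓ → (∀ y → Rel H LH y ℓ → Rel H LH y z) →
    (e : Embedding H (Rel H LH) G LG) →
    ∀ y → Rel H LH y ℓ → W[_] G LG n (φ e z) (φ e y)
lemma2 H conn G LG LH ℓ _ z _ z-max e y yℓ =
  inj₂ ( image-path (φ e) (proj₁ (edges e _ _)) (inj e) walk walk!
       , ∈-map⁺ (φ e) (walk-end H walk)
       , AllP.map⁺ (walk-inside H walk) )
  where
  AboveY : VSet _
  AboveY w = φ e y ⟨ LG ⟩≤ φ e w

  -- z is a descendant of y, so it reaches y through descendants of y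
  z⇝y : ReachIn H AboveY z y
  z⇝y = descendant-walk H LH AboveY (mono e y _) (λ a b _ _ → conn a b) (z-max y yℓ)

  shortest : ∃ λ vs → Walk H AboveY z y vs × Unique (z ∷ vs)
  shortest = shortcut H z⇝y

  walk : Walk H AboveY z y (proj₁ shortest)
  walk = proj₁ (proj₂ shortest)

  walk! : Unique (z ∷ proj₁ shortest)
  walk! = proj₂ (proj₂ shortest)
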